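{- Let $\mathcal{H}$ be an arbitrary $2$-complex on a vertex set of size $n$ and let $F$ be an edge set in $\mathcal{H}$ that is the support of a bad $0$-$1$ function and is smallest possible with this property. Then (i) every vertex of $\mathcal{H}$ has degree less than $\frac n2$ in $F$, and (ii) $F$ is super-connected.
   Context: A $2$-complex consists of vertices, edges (pairs) and faces (triples), downward closed. For a $0$-$1$ function $f$ on the edges of $\mathcal{H}$, its support is the set of edges with value $1$. Such an $f$ is bad if it takes value $1$ on an even number of the three edges of every face, but is not induced by a $0$-$1$ function $g$ on the vertices (i.e. it is not the case that $f(uv)=1$ exactly when $g(u)\ne g(v)$); equivalently, some cycle of the shadow graph (graph of vertices and edges of $\mathcal{H}$) contains an odd number of support edges. An edge set is super-connected if it cannot be partitioned into two non-empty sets such that every face of $\mathcal{H}$ has edges in at most one of the two sets. -}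

module Defs where

open import Data.Nat using (ℕ; zero; suc; _+_; _<ᵇ_) renaming (_≤_ to _≤ℕ_)
open import Data.Bool using (Bool; true; false; _xor_; _∧_; if_then_else_)
open import Data.Fin using (Fin; toℕ)
open import Data.Product using (_×_; ∃; ∃-syntax; Σ-syntax)
open import Relation.Nullary using (¬_)
open import Relation.Binary.PropositionalEquality using (_≡_)

-- A 2-complex on the vertex set Fin n (all n points are vertices).
-- Edges are unordered pairs, encoded as a symmetric irreflexive Bool relation;
-- faces are unordered triples, encoded as a Bool predicate invariant under
-- permutations (generated by the two transpositions); downward closed:
-- every pair inside a face is an edge.
record Complex (n : ℕ) : Set where
  field
    edge        : Fin n → Fin n → Bool
    face        : Fin n → Fin n → Fin n → Bool
    edge-irrefl : ∀ u → edge u u ≡ false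
    edge-sym    : ∀ u v → edge u v ≡ edge v u
    face-sym₁   : ∀ u v w → face u v w ≡ face v u w
    face-sym₂   : ∀ u v w → face u v w ≡ face u w v
    face-edge   : ∀ u v w → face u v w ≡ true → edge u v ≡ true
open Complex public

record IsEdgeFun {n : ℕ} (H : Complex n) (f : Fin n → Fin n → Bool) : Set where
  field
    sym     : ∀ u v → f u v ≡ f v u
    on-edge : ∀ u v → f u v ≡ true → edge H u v ≡ true

EvenOnFaces : ∀ {n} → Complex n → (Fin n → Fin n → Bool) → Set
EvenOnFaces H f = ∀ u v w → face H u v w ≡ true → (f u v xor f v w) xor f u w ≡ false

Induced : ∀ {n} → Complex n → (Fin n → Fin n → Bool) → Set
Induced {n} H f = Σ[ g ∈ (Fin n → Bool) ] (∀ (u v : Fin n) → edge H u v ≡ true → f u v ≡ g u xor g v)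

Bad : ∀ {n} → Complex n → (Fin n → Fin n → Bool) → Set
Bad H f = IsEdgeFun H f × EvenOnFaces H f × ¬ Induced H f

countFin : ∀ {n} → (Fin n → Bool) → ℕ
countFin {zero}  p = 0
countFin {suc n} p = (if p Fin.zero then 1 else 0) + countFin (λ i → p (Fin.suc i))

sumFin : ∀ {n} → (Fin n → ℕ) → ℕ
sumFin {zero}  a = 0
sumFin {suc n} a = a Fin.zero + sumFin (λ i → a (Fin.suc i))

supportSize : ∀ {n} → (Fin n → Fin n → Bool) → ℕ
supportSize f = sumFin (λ u → countFin (λ v → (toℕ u <ᵇ toℕ v) ∧ f u v))

degree : ∀ {n} → (Fin n → Fin n → Bool) → Fin n → ℕ
degree f v = countFin (f v)

MinimalBad : ∀ {n} → Complex n → (Fin n → Fin n → Bool) → Set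
MinimalBad {n} H f = Bad H f × (∀ (f' : Fin n → Fin n → Bool) → Bad H f' → supportSize f ≤ℕ supportSize f')

-- The support F of f is super-connected: for every partition of F into two
-- non-empty parts A = {e ∈ F : c e = 1}, B = {e ∈ F : c e = 0} (c symmetric),
-- some face has edges in both parts. (By permutation-invariance of faces, a face
-- with an edge in A and an edge in B can be written u v w with uv ∈ A, vw ∈ B.)
SuperConnected : ∀ {n} → Complex n → (Fin n → Fin n → Bool) → Set
SuperConnected {n} H f =
  ∀ (c : Fin n → Fin n → Bool) →
  (∀ u v → c u v ≡ c v u) →
  (∃[ u ] ∃[ v ] (f u v ≡ true × c u v ≡ true)) →
  (∃[ u ] ∃[ v ] (f u v ≡ true × c u v ≡ false)) →
  ∃[ u ] ∃[ v ] ∃[ w ] (face H u v w ≡ true ×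
     (f u v ≡ true × c u v ≡ true) × (f v w ≡ true × c v w ≡ false))

-- Switching a bad function f by the cut of a single vertex v (adding, modulo 2, all edges
-- at v) keeps it bad: it changes f by an induced function. The switched support has
-- |F| − deg_F v + (deg_H v − deg_F v) edges, so minimality of F forces
-- 2 deg_F v ≤ deg_H v < n.  If F split into two non-empty parts A, B with no face meeting
-- both, each face would see support edges of only one part, so the restrictions of f to A
-- and to B are both even on faces. They cannot both be induced, since f is their sum, so
-- one of them is bad with a strictly smaller support.
module Submission where

open import Defs
open import Data.Nat using (ℕ; zero; suc; _+_; _*_; _≤_; _<_; _≡ᵇ_; _<ᵇ_; z≤n; s≤s)
open import Data.Fin using (Fin; toℕ)
open import Data.Bool using (Bool; true; false; not; T; _∧_; _xor_; if_then_else_)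
open import Data.Product using (_×_; _,_; ∃-syntax)

open import Algebra.Bundles using (CommutativeRing)
open import Data.Bool.Properties
  using (xor-same; xor-assoc; xor-comm; xor-identityʳ; xor-inverseʳ; ∧-identityʳ; ∧-distribˡ-xor; if-eta; xor-∧-commutativeRing)
import Data.Bool as Bool
open import Data.Empty using (⊥; ⊥-elim)
open import Data.Fin.Properties using (toℕ-injective; any?)
open import Data.Nat.Properties
  using (≤-trans; ≤-<-trans; ≤-antisym; <-irrefl; <-asym; ≮⇒≥; n≮n; m≤m+n; m≤n+m; n≤1+n; m<m+n; m<n+m; module ≤-Reasoning;
         +-identityʳ; *-zeroʳ; +-monoˡ-≤; +-cancelˡ-≤; *-distribˡ-+; ≡ᵇ⇒≡; <ᵇ-reflects-<; +-commutativeSemigroup)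
open import Data.Unit using (tt)
open import Function using (_∘_)
open import Relation.Nullary using (¬_; Dec; yes; no)
open import Relation.Nullary.Decidable using (_×-dec_)
open import Relation.Nullary.Reflects using (ofʸ; ofⁿ)
open import Relation.Binary.PropositionalEquality
open import Algebra.Properties.CommutativeSemigroup (CommutativeRing.+-commutativeSemigroup xor-∧-commutativeRing)
  using () renaming (interchange to xor-interchange)
open import Algebra.Properties.CommutativeSemigroup +-commutativeSemigroup
  using () renaming (interchange to +-interchange)

∧-elimˡ : ∀ {x y} → x ∧ y ≡ true → x ≡ true
∧-elimˡ {true} _ = refl

∧-drop-implied : ∀ {x e} d → (x ≡ true → e ≡ true) → x ∧ (e ∧ d) ≡ x ∧ d
∧-drop-implied {false} d _   = refl
∧-drop-implied {true}  d x⇒e rewrite x⇒e refl = refl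

xor-cancelʳ : ∀ x y → (x xor y) xor y ≡ x
xor-cancelʳ x y = trans (xor-assoc x y y) (trans (cong (x xor_) (xor-same y)) (xor-identityʳ x))

xor-triangle : ∀ a b c → ((a xor b) xor (b xor c)) xor (a xor c) ≡ false
xor-triangle false false false = refl
xor-triangle false false true  = refl
xor-triangle false true  false = refl
xor-triangle false true  true  = refl
xor-triangle true  false false = refl
xor-triangle true  false true  = refl
xor-triangle true  true  false = refl
xor-triangle true  true  true  = refl

∧-preserves-even-parity : ∀ x y z a b c → (x xor y) xor z ≡ false →
  (x ≡ true → y ≡ true → a ≡ b) → (y ≡ true → z ≡ true → b ≡ c) → (x ≡ true → z ≡ true → a ≡ c) →
  ((x ∧ a) xor (y ∧ b)) xor (z ∧ c) ≡ false
∧-preserves-even-parity false false false _ _ _ _ _   _   _   = refl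
∧-preserves-even-parity true  true  false a b _ _ a≡b _   _   rewrite a≡b refl refl = trans (xor-identityʳ (b xor b)) (xor-same b)
∧-preserves-even-parity true  false true  a _ c _ _   _   a≡c rewrite a≡c refl refl = trans (cong (_xor c) (xor-identityʳ c)) (xor-same c)
∧-preserves-even-parity false true  true  _ b c _ _   b≡c _   rewrite b≡c refl refl = xor-same c
∧-preserves-even-parity true  false false _ _ _ ()
∧-preserves-even-parity false true  false _ _ _ ()
∧-preserves-even-parity false false true  _ _ _ ()
∧-preserves-even-parity true  true  true  _ _ _ ()

𝟙 : Bool → ℕ
𝟙 b = if b then 1 else 0

sumFin-cong : ∀ {n} {a b : Fin n → ℕ} → (∀ i → a i ≡ b i) → sumFin a ≡ sumFin b
sumFin-cong {zero}  a≗b = refl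
sumFin-cong {suc n} a≗b = cong₂ _+_ (a≗b Fin.zero) (sumFin-cong (a≗b ∘ Fin.suc))

sumFin-+ : ∀ {n} (a b : Fin n → ℕ) → sumFin (λ i → a i + b i) ≡ sumFin a + sumFin b
sumFin-+ {zero}  a b = refl
sumFin-+ {suc n} a b =
  trans (cong (a Fin.zero + b Fin.zero +_) (sumFin-+ (a ∘ Fin.suc) (b ∘ Fin.suc)))
        (+-interchange (a Fin.zero) (b Fin.zero) _ _)

sumFin-* : ∀ {n} m (a : Fin n → ℕ) → sumFin (λ i → m * a i) ≡ m * sumFin a
sumFin-* {zero}  m a = sym (*-zeroʳ m)
sumFin-* {suc n} m a =
  trans (cong (m * a Fin.zero +_) (sumFin-* m (a ∘ Fin.suc))) (sym (*-distribˡ-+ m _ _))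

sumFin-zero : ∀ {n} → sumFin {n} (λ _ → 0) ≡ 0
sumFin-zero {zero}  = refl
sumFin-zero {suc n} = sumFin-zero {n}

sumFin-if : ∀ {n} b (a : Fin n → ℕ) → sumFin (λ i → if b then a i else 0) ≡ (if b then sumFin a else 0)
sumFin-if     true  a = refl
sumFin-if {n} false a = sumFin-zero {n}

_==_ : ∀ {n} → Fin n → Fin n → Bool
i == j = toℕ i ≡ᵇ toℕ j

==⇒≡ : ∀ {n} {i j : Fin n} → i == j ≡ true → i ≡ j
==⇒≡ {i = i} {j} i==j = toℕ-injective (≡ᵇ⇒≡ (toℕ i) (toℕ j) (subst T (sym i==j) tt))

sumFin-delta : ∀ {n} (j : Fin n) (a : Fin n → ℕ) → sumFin (λ i → if i == j then a i else 0) ≡ a j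
sumFin-delta {suc n} Fin.zero    a = trans (cong (a Fin.zero +_) (sumFin-zero {n})) (+-identityʳ _)
sumFin-delta {suc n} (Fin.suc j) a = sumFin-delta j (a ∘ Fin.suc)

sumFin-entry : ∀ {n} (a : Fin n → ℕ) i → a i ≤ sumFin a
sumFin-entry {suc n} a Fin.zero    = m≤m+n _ _
sumFin-entry {suc n} a (Fin.suc i) = ≤-trans (sumFin-entry (a ∘ Fin.suc) i) (m≤n+m _ _)

countFin≡sumFin : ∀ {n} (p : Fin n → Bool) → countFin p ≡ sumFin (𝟙 ∘ p)
countFin≡sumFin {zero}  p = refl
countFin≡sumFin {suc n} p = cong (𝟙 (p Fin.zero) +_) (countFin≡sumFin (p ∘ Fin.suc))

countFin-≤ : ∀ {n} (p : Fin n → Bool) → countFin p ≤ n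
countFin-≤ {zero}  p = z≤n
countFin-≤ {suc n} p with p Fin.zero
... | true  = s≤s (countFin-≤ (p ∘ Fin.suc))
... | false = ≤-trans (countFin-≤ (p ∘ Fin.suc)) (n≤1+n n)

countFin-< : ∀ {n} (p : Fin n → Bool) i → p i ≡ false → countFin p < n
countFin-< {suc n} p Fin.zero    p₀≡false rewrite p₀≡false = s≤s (countFin-≤ (p ∘ Fin.suc))
countFin-< {suc n} p (Fin.suc i) pᵢ≡false with p Fin.zero
... | true  = s≤s (countFin-< (p ∘ Fin.suc) i pᵢ≡false)
... | false = ≤-trans (countFin-< (p ∘ Fin.suc) i pᵢ≡false) (n≤1+n n)

<ᵇ-irrefl : ∀ m → (m <ᵇ m) ≡ false
<ᵇ-irrefl m with m <ᵇ m | <ᵇ-reflects-< m m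
... | false | _       = refl
... | true  | ofʸ m<m = ⊥-elim (<-irrefl refl m<m)

𝟙-<ᵇ-split : ∀ m n b → (m ≡ n → b ≡ false) → 𝟙 ((m <ᵇ n) ∧ b) + 𝟙 ((n <ᵇ m) ∧ b) ≡ 𝟙 b
𝟙-<ᵇ-split m n b m≡n⇒¬b with m <ᵇ n | <ᵇ-reflects-< m n | n <ᵇ m | <ᵇ-reflects-< n m
... | true  | ofʸ m<n | true  | ofʸ n<m = ⊥-elim (<-asym m<n n<m)
... | true  | _       | false | _       = +-identityʳ (𝟙 b)
... | false | _       | true  | _       = refl
... | false | ofⁿ m≮n | false | ofⁿ n≮m rewrite m≡n⇒¬b (≤-antisym (≮⇒≥ n≮m) (≮⇒≥ m≮n)) = refl

0<+-bounded : ∀ {a b s} → 0 < a + b → a ≤ s → b ≤ s → 0 < s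
0<+-bounded {zero}  0<b _   b≤s = ≤-trans 0<b b≤s
0<+-bounded {suc a} _   a≤s _   = ≤-trans (s≤s z≤n) a≤s

𝟙-xor : ∀ l x y → 𝟙 (l ∧ (x xor y)) + 2 * 𝟙 (l ∧ (x ∧ y)) ≡ 𝟙 (l ∧ x) + 𝟙 (l ∧ y)
𝟙-xor false _     _     = refl
𝟙-xor true  false false = refl
𝟙-xor true  false true  = refl
𝟙-xor true  true  false = refl
𝟙-xor true  true  true  = refl

𝟙-partition : ∀ l x c → 𝟙 (l ∧ x) ≡ 𝟙 (l ∧ (x ∧ c)) + 𝟙 (l ∧ (x ∧ not c))
𝟙-partition false _     _     = refl
𝟙-partition true  false _     = refl
𝟙-partition true  true  false = refl
𝟙-partition true  true  true  = refl

𝟙-∧-xor : ∀ l x a b → (a ≡ true → b ≡ true → l ≡ false) →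
  𝟙 (l ∧ (x ∧ (a xor b))) ≡ (if a then 𝟙 (l ∧ x) else 0) + (if b then 𝟙 (l ∧ x) else 0)
𝟙-∧-xor false _     a     b     _ = sym (cong₂ _+_ (if-eta a) (if-eta b))
𝟙-∧-xor true  false a     b     _ = sym (cong₂ _+_ (if-eta a) (if-eta b))
𝟙-∧-xor true  true  false false _ = refl
𝟙-∧-xor true  true  false true  _ = refl
𝟙-∧-xor true  true  true  false _ = refl
𝟙-∧-xor true  true  true  true  a∧b⇒¬l with () ← a∧b⇒¬l refl refl

pairSum : ∀ {n} → (Fin n → Fin n → ℕ) → ℕ
pairSum a = sumFin λ u → sumFin (a u)

pairSum-cong : ∀ {n} {a b : Fin n → Fin n → ℕ} → (∀ u w → a u w ≡ b u w) → pairSum a ≡ pairSum b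
pairSum-cong a≗b = sumFin-cong λ u → sumFin-cong (a≗b u)

pairSum-+ : ∀ {n} (a b : Fin n → Fin n → ℕ) → pairSum (λ u w → a u w + b u w) ≡ pairSum a + pairSum b
pairSum-+ a b = trans (sumFin-cong λ u → sumFin-+ (a u) (b u)) (sumFin-+ (sumFin ∘ a) (sumFin ∘ b))

pairSum-* : ∀ {n} m (a : Fin n → Fin n → ℕ) → pairSum (λ u w → m * a u w) ≡ m * pairSum a
pairSum-* m a = trans (sumFin-cong λ u → sumFin-* m (a u)) (sumFin-* m (sumFin ∘ a))

pairSum-entry : ∀ {n} (a : Fin n → Fin n → ℕ) u w → a u w ≤ pairSum a
pairSum-entry a u w = ≤-trans (sumFin-entry (a u) w) (sumFin-entry (sumFin ∘ a) u)

upper : ∀ {n} → (Fin n → Fin n → Bool) → Fin n → Fin n → ℕ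
upper f u w = 𝟙 ((toℕ u <ᵇ toℕ w) ∧ f u w)

supportSize≡pairSum : ∀ {n} (f : Fin n → Fin n → Bool) → supportSize f ≡ pairSum (upper f)
supportSize≡pairSum f = sumFin-cong λ u → countFin≡sumFin (λ w → (toℕ u <ᵇ toℕ w) ∧ f u w)

supportSize-cong : ∀ {n} {f g : Fin n → Fin n → Bool} → (∀ u w → f u w ≡ g u w) → supportSize f ≡ supportSize g
supportSize-cong {f = f} {g} f≗g = begin
  supportSize f     ≡⟨ supportSize≡pairSum f ⟩
  pairSum (upper f) ≡⟨ pairSum-cong (λ u w → cong (λ b → 𝟙 ((toℕ u <ᵇ toℕ w) ∧ b)) (f≗g u w)) ⟩
  pairSum (upper g) ≡⟨ supportSize≡pairSum g ⟨
  supportSize g     ∎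
  where open ≡-Reasoning

supportSize-xor : ∀ {n} (f g : Fin n → Fin n → Bool) →
  supportSize (λ u w → f u w xor g u w) + 2 * supportSize (λ u w → f u w ∧ g u w) ≡ supportSize f + supportSize g
supportSize-xor {n} f g = begin
  supportSize f⊕g + 2 * supportSize f∧g
    ≡⟨ cong₂ (λ a b → a + 2 * b) (supportSize≡pairSum f⊕g) (supportSize≡pairSum f∧g) ⟩
  pairSum (upper f⊕g) + 2 * pairSum (upper f∧g)
    ≡⟨ cong (pairSum (upper f⊕g) +_) (pairSum-* 2 (upper f∧g)) ⟨
  pairSum (upper f⊕g) + pairSum (λ u w → 2 * upper f∧g u w)
    ≡⟨ pairSum-+ (upper f⊕g) (λ u w → 2 * upper f∧g u w) ⟨
  pairSum (λ u w → upper f⊕g u w + 2 * upper f∧g u w)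
    ≡⟨ pairSum-cong (λ u w → 𝟙-xor (toℕ u <ᵇ toℕ w) (f u w) (g u w)) ⟩
  pairSum (λ u w → upper f u w + upper g u w)
    ≡⟨ pairSum-+ (upper f) (upper g) ⟩
  pairSum (upper f) + pairSum (upper g)
    ≡⟨ cong₂ _+_ (supportSize≡pairSum f) (supportSize≡pairSum g) ⟨
  supportSize f + supportSize g ∎
  where
  open ≡-Reasoning
  f⊕g f∧g : Fin n → Fin n → Bool
  f⊕g u w = f u w xor g u w
  f∧g u w = f u w ∧ g u w

supportSize-partition : ∀ {n} (f c : Fin n → Fin n → Bool) →
  supportSize f ≡ supportSize (λ u w → f u w ∧ c u w) + supportSize (λ u w → f u w ∧ not (c u w))
supportSize-partition {n} f c = begin
  supportSize f
    ≡⟨ supportSize≡pairSum f ⟩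
  pairSum (upper f)
    ≡⟨ pairSum-cong (λ u w → 𝟙-partition (toℕ u <ᵇ toℕ w) (f u w) (c u w)) ⟩
  pairSum (λ u w → upper f∧c u w + upper f∧¬c u w)
    ≡⟨ pairSum-+ (upper f∧c) (upper f∧¬c) ⟩
  pairSum (upper f∧c) + pairSum (upper f∧¬c)
    ≡⟨ cong₂ _+_ (supportSize≡pairSum f∧c) (supportSize≡pairSum f∧¬c) ⟨
  supportSize f∧c + supportSize f∧¬c ∎
  where
  open ≡-Reasoning
  f∧c f∧¬c : Fin n → Fin n → Bool
  f∧c u w = f u w ∧ c u w
  f∧¬c u w = f u w ∧ not (c u w)

supportSize-positive : ∀ {n} {g : Fin n → Fin n → Bool} → (∀ u w → g u w ≡ g w u) → (∀ u → g u u ≡ false) →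
  ∀ {u w} → g u w ≡ true → 0 < supportSize g
supportSize-positive {g = g} g-sym g-irrefl {u} {w} g-uw =
  subst (0 <_) (sym (supportSize≡pairSum g))
    (0<+-bounded (subst (0 <_) (sym both) (s≤s z≤n)) (pairSum-entry (upper g) u w) (pairSum-entry (upper g) w u))
  where
  open ≡-Reasoning
  both : upper g u w + upper g w u ≡ 1
  both = begin
    upper g u w + upper g w u
      ≡⟨ cong (λ b → upper g u w + 𝟙 ((toℕ w <ᵇ toℕ u) ∧ b)) (g-sym w u) ⟩
    upper g u w + 𝟙 ((toℕ w <ᵇ toℕ u) ∧ g u w)
      ≡⟨ 𝟙-<ᵇ-split (toℕ u) (toℕ w) (g u w) (λ u≡w → subst (λ x → g u x ≡ false) (toℕ-injective u≡w) (g-irrefl u)) ⟩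
    𝟙 (g u w)
      ≡⟨ cong 𝟙 g-uw ⟩
    1 ∎

supportSize-star : ∀ {n} {g : Fin n → Fin n → Bool} → (∀ u w → g u w ≡ g w u) → ∀ v → g v v ≡ false →
  supportSize (λ u w → g u w ∧ ((u == v) xor (w == v))) ≡ degree g v
supportSize-star {n} {g} g-sym v gᵥᵥ≡false = begin
  supportSize g-at-v
    ≡⟨ supportSize≡pairSum g-at-v ⟩
  pairSum (upper g-at-v)
    ≡⟨ pairSum-cong (λ u w → 𝟙-∧-xor (toℕ u <ᵇ toℕ w) (g u w) (u == v) (w == v) (not-both-v u w)) ⟩
  pairSum (λ u w → (if u == v then upper g u w else 0) + (if w == v then upper g u w else 0))
    ≡⟨ pairSum-+ (λ u w → if u == v then upper g u w else 0) (λ u w → if w == v then upper g u w else 0) ⟩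
  pairSum (λ u w → if u == v then upper g u w else 0) + pairSum (λ u w → if w == v then upper g u w else 0)
    ≡⟨ cong₂ _+_ row column ⟩
  sumFin (upper g v) + sumFin (λ w → 𝟙 ((toℕ w <ᵇ toℕ v) ∧ g v w))
    ≡⟨ sumFin-+ (upper g v) (λ w → 𝟙 ((toℕ w <ᵇ toℕ v) ∧ g v w)) ⟨
  sumFin (λ w → upper g v w + 𝟙 ((toℕ w <ᵇ toℕ v) ∧ g v w))
    ≡⟨ sumFin-cong (λ w → 𝟙-<ᵇ-split (toℕ v) (toℕ w) (g v w) (λ v≡w → subst (λ x → g v x ≡ false) (toℕ-injective v≡w) gᵥᵥ≡false)) ⟩
  sumFin (𝟙 ∘ g v)
    ≡⟨ countFin≡sumFin (g v) ⟨
  degree g v ∎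
  where
  open ≡-Reasoning
  g-at-v : Fin n → Fin n → Bool
  g-at-v u w = g u w ∧ ((u == v) xor (w == v))
  not-both-v : ∀ u w → u == v ≡ true → w == v ≡ true → (toℕ u <ᵇ toℕ w) ≡ false
  not-both-v u w u==v w==v = trans (cong₂ (λ a b → toℕ a <ᵇ toℕ b) (==⇒≡ {i = u} u==v) (==⇒≡ {i = w} w==v)) (<ᵇ-irrefl (toℕ v))
  row : pairSum (λ u w → if u == v then upper g u w else 0) ≡ sumFin (upper g v)
  row = trans (sumFin-cong λ u → sumFin-if (u == v) (upper g u)) (sumFin-delta v (sumFin ∘ upper g))
  column : pairSum (λ u w → if w == v then upper g u w else 0) ≡ sumFin (λ u → 𝟙 ((toℕ u <ᵇ toℕ v) ∧ g v u))
  column = sumFin-cong λ u → trans (sumFin-delta v (upper g u)) (cong (λ b → 𝟙 ((toℕ u <ᵇ toℕ v) ∧ b)) (g-sym u v))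

module _ {n : ℕ} (H : Complex n) where

  face-swap : ∀ {u w z} → face H u w z ≡ true → face H w u z ≡ true
  face-swap {u} {w} {z} h = trans (face-sym₁ H w u z) h

  face-rotate : ∀ {u w z} → face H u w z ≡ true → face H w z u ≡ true
  face-rotate {u} {w} {z} h = trans (face-sym₂ H w z u) (face-swap h)

  IsEdgeFun-irrefl : ∀ {f} → IsEdgeFun H f → ∀ u → f u u ≡ false
  IsEdgeFun-irrefl {f} ef u with f u u in f-uu
  ... | false = refl
  ... | true with () ← trans (sym (IsEdgeFun.on-edge ef u u f-uu)) (edge-irrefl H u)

  IsEdgeFun-xor : ∀ {f g} → IsEdgeFun H f → IsEdgeFun H g → IsEdgeFun H (λ u w → f u w xor g u w)
  IsEdgeFun-xor {f} {g} ef eg = record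
    { sym     = λ u w → cong₂ _xor_ (IsEdgeFun.sym ef u w) (IsEdgeFun.sym eg u w)
    ; on-edge = on-edge
    }
    where
    on-edge : ∀ u w → f u w xor g u w ≡ true → edge H u w ≡ true
    on-edge u w f⊕g with f u w in f-uw
    ... | true  = IsEdgeFun.on-edge ef u w f-uw
    ... | false = IsEdgeFun.on-edge eg u w f⊕g

  IsEdgeFun-∧ : ∀ {f c : Fin n → Fin n → Bool} → IsEdgeFun H f → (∀ u w → c u w ≡ c w u) → IsEdgeFun H (λ u w → f u w ∧ c u w)
  IsEdgeFun-∧ {f} {c} ef c-sym = record
    { sym     = λ u w → cong₂ _∧_ (IsEdgeFun.sym ef u w) (c-sym u w)
    ; on-edge = λ u w → IsEdgeFun.on-edge ef u w ∘ ∧-elimˡ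
    }

  cut : (Fin n → Bool) → Fin n → Fin n → Bool
  cut g u w = edge H u w ∧ (g u xor g w)

  IsEdgeFun-cut : ∀ g → IsEdgeFun H (cut g)
  IsEdgeFun-cut g = record
    { sym     = λ u w → cong₂ _∧_ (edge-sym H u w) (xor-comm (g u) (g w))
    ; on-edge = λ u w → ∧-elimˡ
    }

  Induced-cut : ∀ g → Induced H (cut g)
  Induced-cut g = g , λ u w e-uw → cong (_∧ (g u xor g w)) e-uw

  Induced-cong : ∀ {f f′} → (∀ u w → f u w ≡ f′ u w) → Induced H f → Induced H f′
  Induced-cong f≗f′ (g , f≡δg) = g , λ u w e-uw → trans (sym (f≗f′ u w)) (f≡δg u w e-uw)

  Induced-xor : ∀ {f f′} → Induced H f → Induced H f′ → Induced H (λ u w → f u w xor f′ u w)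
  Induced-xor (g , f≡δg) (g′ , f′≡δg′) = (λ u → g u xor g′ u) , λ u w e-uw →
    trans (cong₂ _xor_ (f≡δg u w e-uw) (f′≡δg′ u w e-uw)) (xor-interchange (g u) (g w) (g′ u) (g′ w))

  Induced⇒EvenOnFaces : ∀ {f} → Induced H f → EvenOnFaces H f
  Induced⇒EvenOnFaces (g , f≡δg) u w z h
    rewrite f≡δg u w (face-edge H u w z h)
          | f≡δg w z (face-edge H w z u (face-rotate h))
          | f≡δg u z (face-edge H u z w (trans (face-sym₂ H u z w) h))
    = xor-triangle (g u) (g w) (g z)

  EvenOnFaces-xor : ∀ {f f′} → EvenOnFaces H f → EvenOnFaces H f′ → EvenOnFaces H (λ u w → f u w xor f′ u w)
  EvenOnFaces-xor {f} {f′} ev ev′ u w z h = begin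
    ((f u w xor f′ u w) xor (f w z xor f′ w z)) xor (f u z xor f′ u z)
      ≡⟨ cong (_xor (f u z xor f′ u z)) (xor-interchange (f u w) (f′ u w) (f w z) (f′ w z)) ⟩
    ((f u w xor f w z) xor (f′ u w xor f′ w z)) xor (f u z xor f′ u z)
      ≡⟨ xor-interchange (f u w xor f w z) (f′ u w xor f′ w z) (f u z) (f′ u z) ⟩
    ((f u w xor f w z) xor f u z) xor ((f′ u w xor f′ w z) xor f′ u z)
      ≡⟨ cong₂ _xor_ (ev u w z h) (ev′ u w z h) ⟩
    false ∎
    where open ≡-Reasoning

  Bad-xor-induced : ∀ {f s} → Bad H f → IsEdgeFun H s → Induced H s → Bad H (λ u w → f u w xor s u w)
  Bad-xor-induced {f} {s} (ef , ev , ¬If) es Is =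
    IsEdgeFun-xor ef es ,
    EvenOnFaces-xor {f} {s} ev (Induced⇒EvenOnFaces Is) ,
    λ If⊕s → ¬If (Induced-cong (λ u w → xor-cancelʳ (f u w) (s u w)) (Induced-xor If⊕s Is))

  MinimalBad⇒2*degree≤degree : ∀ {f} → MinimalBad H f → ∀ v → 2 * degree f v ≤ degree (edge H) v
  MinimalBad⇒2*degree≤degree {f} (bad@(ef , _) , minimal) v = +-cancelˡ-≤ (supportSize f) _ _ (begin
    supportSize f + 2 * degree f v
      ≤⟨ +-monoˡ-≤ (2 * degree f v) (minimal f⊕s (Bad-xor-induced bad (IsEdgeFun-cut (_== v)) (Induced-cut (_== v)))) ⟩
    supportSize f⊕s + 2 * degree f v
      ≡⟨ cong (λ d → supportSize f⊕s + 2 * d) f-at-v ⟨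
    supportSize f⊕s + 2 * supportSize f∧s
      ≡⟨ supportSize-xor f s ⟩
    supportSize f + supportSize s
      ≡⟨ cong (supportSize f +_) (supportSize-star (edge-sym H) v (edge-irrefl H v)) ⟩
    supportSize f + degree (edge H) v ∎)
    where
    open ≤-Reasoning
    s f⊕s f∧s : Fin n → Fin n → Bool
    s = cut (_== v)
    f⊕s u w = f u w xor s u w
    f∧s u w = f u w ∧ s u w
    f-at-v : supportSize f∧s ≡ degree f v
    f-at-v = trans (supportSize-cong λ u w → ∧-drop-implied ((u == v) xor (w == v)) (IsEdgeFun.on-edge ef u w))
                   (supportSize-star (IsEdgeFun.sym ef) v (IsEdgeFun-irrefl ef v))

  MixedFace : (f c : Fin n → Fin n → Bool) → Set
  MixedFace f c = ∃[ u ] ∃[ v ] ∃[ w ]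
    (face H u v w ≡ true × (f u v ≡ true × c u v ≡ true) × (f v w ≡ true × c v w ≡ false))

  mixedFace? : ∀ f c → Dec (MixedFace f c)
  mixedFace? f c = any? λ u → any? λ v → any? λ w →
    (face H u v w Bool.≟ true) ×-dec ((f u v Bool.≟ true) ×-dec (c u v Bool.≟ true))
                               ×-dec ((f v w Bool.≟ true) ×-dec (c v w Bool.≟ false))

  Monochromatic : (f c : Fin n → Fin n → Bool) → Set
  Monochromatic f c = ∀ u w z → face H u w z ≡ true → f u w ≡ true → f w z ≡ true → c u w ≡ c w z

  ¬MixedFace⇒Monochromatic : ∀ {f c : Fin n → Fin n → Bool} → (∀ u w → f u w ≡ f w u) → (∀ u w → c u w ≡ c w u) →
    ¬ MixedFace f c → Monochromatic f c
  ¬MixedFace⇒Monochromatic {f} {c} f-sym c-sym ¬mixed u w z h f-uw f-wz with c u w in c-uw | c w z in c-wz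
  ... | true  | true  = refl
  ... | false | false = refl
  ... | true  | false = ⊥-elim (¬mixed (u , w , z , h , (f-uw , c-uw) , (f-wz , c-wz)))
  ... | false | true  = ⊥-elim (¬mixed (z , w , u , face-swap (face-rotate h) ,
        (trans (f-sym z w) f-wz , trans (c-sym z w) c-wz) , (trans (f-sym w u) f-uw , trans (c-sym w u) c-uw)))

  Monochromatic-not : ∀ {f c} → Monochromatic f c → Monochromatic f (λ u w → not (c u w))
  Monochromatic-not mono u w z h f-uw f-wz = cong not (mono u w z h f-uw f-wz)

  EvenOnFaces-∧ : ∀ {f c : Fin n → Fin n → Bool} → (∀ u w → f u w ≡ f w u) → (∀ u w → c u w ≡ c w u) →
    EvenOnFaces H f → Monochromatic f c → EvenOnFaces H (λ u w → f u w ∧ c u w)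
  EvenOnFaces-∧ {f} {c} f-sym c-sym ev mono u w z h =
    ∧-preserves-even-parity (f u w) (f w z) (f u z) (c u w) (c w z) (c u z) (ev u w z h)
      (mono u w z h)
      (λ f-wz f-uz → trans (mono w z u (face-rotate h) f-wz (trans (f-sym z u) f-uz)) (c-sym z u))
      (λ f-uw f-uz → trans (c-sym u w) (mono w u z (face-swap h) (trans (f-sym w u) f-uw) f-uz))

  MinimalBad⇒¬Monochromatic : ∀ {f c : Fin n → Fin n → Bool} → MinimalBad H f → (∀ u w → c u w ≡ c w u) →
    Monochromatic f c → ∃[ u ] ∃[ w ] (f u w ≡ true × c u w ≡ true) → ∃[ u ] ∃[ w ] (f u w ≡ true × c u w ≡ false) → ⊥
  MinimalBad⇒¬Monochromatic {f} {c} ((ef , ev , ¬If) , minimal) c-sym mono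
    (u , w , f-uw , c-uw) (u′ , w′ , f-u′w′ , c-u′w′) =
    n≮n _ (≤-<-trans (minimal fA (bad-restriction {c} c-sym mono ¬IA)) fA<f)
    where
    fA fB : Fin n → Fin n → Bool
    fA u w = f u w ∧ c u w
    fB u w = f u w ∧ not (c u w)
    ¬c-sym : ∀ u w → not (c u w) ≡ not (c w u)
    ¬c-sym u w = cong not (c-sym u w)
    bad-restriction : ∀ {b : Fin n → Fin n → Bool} → (∀ u w → b u w ≡ b w u) → Monochromatic f b →
      ¬ Induced H (λ u w → f u w ∧ b u w) → Bad H (λ u w → f u w ∧ b u w)
    bad-restriction b-sym mono-b ¬I = IsEdgeFun-∧ ef b-sym , EvenOnFaces-∧ (IsEdgeFun.sym ef) b-sym ev mono-b , ¬I
    positive : ∀ {b : Fin n → Fin n → Bool} → (∀ u w → b u w ≡ b w u) →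
      ∀ {u w} → f u w ∧ b u w ≡ true → 0 < supportSize (λ u w → f u w ∧ b u w)
    positive b-sym = supportSize-positive (IsEdgeFun.sym (IsEdgeFun-∧ ef b-sym)) (IsEdgeFun-irrefl (IsEdgeFun-∧ ef b-sym))
    fA<f : supportSize fA < supportSize f
    fA<f = subst (supportSize fA <_) (sym (supportSize-partition f c))
      (m<m+n _ (positive {λ u w → not (c u w)} ¬c-sym (cong₂ _∧_ f-u′w′ (cong not c-u′w′))))
    fB<f : supportSize fB < supportSize f
    fB<f = subst (supportSize fB <_) (sym (supportSize-partition f c))
      (m<n+m _ (positive {c} c-sym (cong₂ _∧_ f-uw c-uw)))
    recombine : ∀ u w → fA u w xor fB u w ≡ f u w
    recombine u w = trans (sym (∧-distribˡ-xor (f u w) (c u w) (not (c u w))))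
                          (trans (cong (f u w ∧_) (xor-inverseʳ (c u w))) (∧-identityʳ (f u w)))
    ¬IA : ¬ Induced H fA
    ¬IA IA = n≮n _
      (≤-<-trans (minimal fB (bad-restriction {λ u w → not (c u w)} ¬c-sym (Monochromatic-not mono) ¬IB)) fB<f)
      where
      ¬IB : ¬ Induced H fB
      ¬IB IB = ¬If (Induced-cong recombine (Induced-xor IA IB))

  -- Deciding MixedFace (a finite search) is what produces the witness constructively.
  MinimalBad⇒SuperConnected : ∀ {f} → MinimalBad H f → SuperConnected H f
  MinimalBad⇒SuperConnected {f} minBad@((ef , _) , _) c c-sym inA inB with mixedFace? f c
  ... | yes mixed = mixed
  ... | no ¬mixed = ⊥-elim (MinimalBad⇒¬Monochromatic minBad c-sym
                      (¬MixedFace⇒Monochromatic (IsEdgeFun.sym ef) c-sym ¬mixed) inA inB)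

lemma5p2 : ∀ (n : ℕ) (H : Complex n) (f : Fin n → Fin n → Bool) →
    MinimalBad H f →
    (∀ (v : Fin n) → 2 * degree f v < n) × SuperConnected H f
lemma5p2 n H f minBad =
  (λ v → ≤-<-trans (MinimalBad⇒2*degree≤degree H minBad v) (countFin-< (edge H v) v (edge-irrefl H v))) ,
  MinimalBad⇒SuperConnected H minBad
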